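{- Let $\delta,l,w\in\mathbb{Z}^+$ with $0<\delta<2^w$ and $\delta-2^{w+l}\%\delta\le 2^l$. Set $\alpha'=2^{w+l}/\delta+1$. Then $n\%\delta=\delta\cdot(\alpha'\cdot n\%2^{w+l})/2^{w+l}$ for all $n\in[0,2^w[$.
   Context: For $n,\delta\in\mathbb{Z}$ with $\delta\neq0$, $n/\delta$ and $n\%\delta$ denote the quotient and remainder of Euclidean division: the unique integers $q,s$ with $n=q\cdot\delta+s$ and $0\le s<|\delta|$. The operators $\cdot$, $/$, $\%$ have equal precedence and associate left to right. $\mathbb{Z}^+=\{x\in\mathbb{Z}: x\ge0\}$. For integers $a,b$, $[a,b[$ denotes $\{r\in\mathbb{Z}: a\le r<b\}$. -}

module Defs where

open import Data.Nat using (ℕ; _^_; _<_; NonZero; >-nonZero)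
open import Data.Nat.Properties using (m^n≢0)
import Data.Nat.DivMod as DM

-- Euclidean division / remainder on natural numbers (all quantities in the
-- statement are nonnegative, so Euclidean division coincides with ℕ division).
divP : ℕ → (d : ℕ) → 0 < d → ℕ
divP n d p = DM._/_ n d {{>-nonZero p}}

modP : ℕ → (d : ℕ) → 0 < d → ℕ
modP n d p = DM._%_ n d {{>-nonZero p}}

div2^ : ℕ → ℕ → ℕ
div2^ n k = DM._/_ n (2 ^ k) {{m^n≢0 2 k}}

mod2^ : ℕ → ℕ → ℕ
mod2^ n k = DM._%_ n (2 ^ k) {{m^n≢0 2 k}}

-- Write N = 2^(w+l), α' = N/δ + 1 and e = δ − N%δ, so that α'·δ = N + e: α' is N/δ
-- rounded up, with excess e.  For n = q·δ + s one finds α'·n = X + q·N with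
-- X = q·e + α'·s and δ·X = e·n + s·N.  The hypotheses give e·n < 2^l·2^w = N, hence
-- X < N, so α'·n % N = X and δ·X / N = s = n % δ.
module Submission where

open import Defs
open import Data.Nat using (ℕ; suc; _+_; _*_; _∸_; _^_; _≤_; _<_; s≤s; z≤n; NonZero)
open import Data.Nat.Properties
open import Data.Nat.DivMod
open import Data.Nat.Divisibility using (divides-refl)
open import Data.Nat.Solver using (module +-*-Solver)
open import Relation.Binary.PropositionalEquality
open +-*-Solver

[m+kn]/n≡k : ∀ {m n} k .{{_ : NonZero n}} → m < n → (m + k * n) / n ≡ k
[m+kn]/n≡k {m} {n} k m<n = begin
  (m + k * n) / n   ≡⟨ +-distrib-/-∣ʳ m (divides-refl k) ⟩
  m / n + k * n / n ≡⟨ cong₂ _+_ (m<n⇒m/n≡0 m<n) (m*n/n≡m k n) ⟩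
  k                 ∎
  where open ≡-Reasoning

[m/n+1]*n≡m+[n∸m%n] : ∀ m n .{{_ : NonZero n}} → (m / n + 1) * n ≡ m + (n ∸ m % n)
[m/n+1]*n≡m+[n∸m%n] m n = begin
  (m / n + 1) * n            ≡⟨ solve 2 (λ q n → (q :+ con 1) :* n := q :* n :+ n) refl (m / n) n ⟩
  m / n * n + n              ≡⟨ cong (m / n * n +_) (sym (m∸n+n≡m (<⇒≤ (m%n<n m n)))) ⟩
  m / n * n + (e + m % n)    ≡⟨ solve 3 (λ a e r → a :+ (e :+ r) := (r :+ a) :+ e) refl (m / n * n) e (m % n) ⟩
  (m % n + m / n * n) + e    ≡⟨ cong (_+ e) (sym (m≡m%n+[m/n]*n m n)) ⟩
  m + e                      ∎
  where
  open ≡-Reasoning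
  e = n ∸ m % n

-- α·δ = N + e says that α overestimates N/δ by e/δ; the bound e·n < N keeps the
-- accumulated error from spilling into the high part.
δ*[αn%N]/N≡n%δ : ∀ {N δ α e} n .{{_ : NonZero N}} .{{_ : NonZero δ}} →
                 α * δ ≡ N + e → e * n < N → δ * ((α * n) % N) / N ≡ n % δ
δ*[αn%N]/N≡n%δ {N} {δ} {α} {e} n αδ≡N+e en<N = begin
  δ * ((α * n) % N) / N ≡⟨ cong (λ x → δ * x / N) αn%N≡X ⟩
  δ * X / N             ≡⟨ cong (_/ N) δX≡en+sN ⟩
  (e * n + s * N) / N   ≡⟨ [m+kn]/n≡k s en<N ⟩
  s                     ∎
  where
  open ≡-Reasoning
  q = n / δ
  s = n % δ
  X = q * e + α * s

  n≡s+qδ : n ≡ s + q * δ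
  n≡s+qδ = m≡m%n+[m/n]*n n δ

  αn≡X+qN : α * n ≡ X + q * N
  αn≡X+qN = begin
    α * n               ≡⟨ cong (α *_) n≡s+qδ ⟩
    α * (s + q * δ)     ≡⟨ solve 4 (λ α s q δ → α :* (s :+ q :* δ) := α :* s :+ q :* (α :* δ)) refl α s q δ ⟩
    α * s + q * (α * δ) ≡⟨ cong (λ y → α * s + q * y) αδ≡N+e ⟩
    α * s + q * (N + e) ≡⟨ solve 5 (λ A q N e s → A :+ q :* (N :+ e) := (q :* e :+ A) :+ q :* N) refl (α * s) q N e s ⟩
    X + q * N           ∎

  δX≡en+sN : δ * X ≡ e * n + s * N
  δX≡en+sN = begin
    δ * X                       ≡⟨ solve 5 (λ δ q e α s → δ :* (q :* e :+ α :* s) := e :* (q :* δ) :+ s :* (α :* δ)) refl δ q e α s ⟩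
    e * (q * δ) + s * (α * δ)   ≡⟨ cong (λ y → e * (q * δ) + s * y) αδ≡N+e ⟩
    e * (q * δ) + s * (N + e)   ≡⟨ solve 4 (λ e a s N → e :* a :+ s :* (N :+ e) := e :* (s :+ a) :+ s :* N) refl e (q * δ) s N ⟩
    e * (s + q * δ) + s * N     ≡⟨ cong (λ y → e * y + s * N) (sym n≡s+qδ) ⟩
    e * n + s * N               ∎

  X<N : X < N
  X<N = *-cancelˡ-< δ X N (subst (_< δ * N) (sym δX≡en+sN)
          (<-≤-trans (+-monoˡ-< (s * N) en<N) (*-monoˡ-≤ N (m%n<n n δ))))

  αn%N≡X : (α * n) % N ≡ X
  αn%N≡X = begin
    (α * n) % N     ≡⟨ cong (_% N) αn≡X+qN ⟩
    (X + q * N) % N ≡⟨ [m+kn]%n≡m%n X q N ⟩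
    X % N           ≡⟨ m<n⇒m%n≡m X<N ⟩
    X               ∎

corollary1 : (δ l w : ℕ) → (δpos : 0 < δ) → δ < 2 ^ w →
    δ ∸ modP (2 ^ (w + l)) δ δpos ≤ 2 ^ l →
    (n : ℕ) → n < 2 ^ w →
    modP n δ δpos ≡ div2^ (δ * mod2^ ((divP (2 ^ (w + l)) δ δpos + 1) * n) (w + l)) (w + l)
corollary1 δ@(suc _) l w (s≤s z≤n) _ e≤2^l n n<2^w =
  sym (δ*[αn%N]/N≡n%δ {α = N / δ + 1} n ([m/n+1]*n≡m+[n∸m%n] N δ) en<N)
  where
  open ≤-Reasoning
  N = 2 ^ (w + l)
  instance
    N≢0 : NonZero N
    N≢0 = m^n≢0 2 (w + l)

  en<N : (δ ∸ N % δ) * n < N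
  en<N = begin-strict
    (δ ∸ N % δ) * n ≤⟨ *-monoˡ-≤ n e≤2^l ⟩
    2 ^ l * n       <⟨ *-monoʳ-< (2 ^ l) {{m^n≢0 2 l}} n<2^w ⟩
    2 ^ l * 2 ^ w   ≡⟨ sym (^-distribˡ-+-* 2 l w) ⟩
    2 ^ (l + w)     ≡⟨ cong (2 ^_) (+-comm l w) ⟩
    N               ∎
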